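{- For every coloring game on $n$ players (with arbitrary weights in $\mathbb{Z}\cup\{ -\infty\}$), if only $1$-deviations are allowed, the dynamics always converges (to a $1$-stable partition) in $O(w_p n^2)$ steps, where $w_p$ denotes the largest positive weight of the game if there is one, and $0$ otherwise.
   Context: A coloring game is given by a finite set $V$ of $n$ players and a symmetric weight function $w$ with $w_{uv}=w_{vu}\in \mathbb{Z}\cup\{ -\infty\}$ for distinct $u,v$ (pairs with weight $-\infty$ are enemies). A state is a partition $P$ of $V$; $X(u)$ is the group of $u$ and $f_u(P)=\sum_{v\in X(u)\setminus\{u\}} w_{uv}$. A $k$-deviation from $P$ is a set $S$ of at most $k$ players and a (possibly empty) group $X$ of $P$ such that moving all players of $S$ into $X$ strictly increases the utility of every member of $S$. A partition is $k$-stable if no $k$-deviation exists. The dynamics starts from the all-singletons partition and applies an arbitrary $k$-deviation as long as one exists. -}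

module Defs where

open import Data.Nat as ℕ using (ℕ; _⊔_)
open import Data.Integer as ℤ using (ℤ; +_; -[1+_])
open import Data.Fin using (Fin; _≟_)
open import Data.List using (List; foldr; map; filter; allFin)
open import Data.Bool using (if_then_else_)
open import Relation.Nullary using (¬_; ¬?; does)
open import Relation.Nullary.Decidable using (_×-dec_)
open import Relation.Binary.PropositionalEquality using (_≡_; _≢_)

data ℤ∞ : Set where
  -∞  : ℤ∞
  fin : ℤ → ℤ∞

_⊕_ : ℤ∞ → ℤ∞ → ℤ∞
-∞    ⊕ _     = -∞
fin _ ⊕ -∞    = -∞
fin a ⊕ fin b = fin (a ℤ.+ b)

data _<∞_ : ℤ∞ → ℤ∞ → Set where
  -∞<fin : ∀ {b} → -∞ <∞ fin b
  fin<fin : ∀ {a b} → a ℤ.< b → fin a <∞ fin b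

record Game (n : ℕ) : Set where
  field
    w   : Fin n → Fin n → ℤ∞
    sym : ∀ u v → u ≢ v → w u v ≡ w v u
open Game public

-- A state (partition of the players) is given by a group label for each player;
-- two players are in the same group iff they have the same label.
-- Labels in Fin n suffice since a partition has at most n groups.
State : ℕ → Set
State n = Fin n → Fin n

singletons : ∀ {n} → State n
singletons u = u

gain : ∀ {n} → Game n → State n → Fin n → Fin n → ℤ∞
gain {n} G σ u c =
  foldr _⊕_ (fin (+ 0))
    (map (w G u) (filter (λ v → ¬? (v ≟ u) ×-dec (σ v ≟ c)) (allFin n)))

utility : ∀ {n} → Game n → State n → Fin n → ℤ∞
utility G σ u = gain G σ u (σ u)

move : ∀ {n} → State n → Fin n → Fin n → State n
move σ u c v = if does (v ≟ u) then c else σ v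

-- A 1-deviation: a single player u moves into the group labelled c
-- (an existing group of σ, or the empty group if c is unused),
-- strictly increasing its utility.  σ' is the resulting state.
Step1 : ∀ {n} → Game n → State n → State n → Set
Step1 {n} G σ σ' =
  Σ' (Fin n) λ u → Σ' (Fin n) λ c →
    (utility G σ u <∞ utility G (move σ u c) u) ×' (σ' ≡ move σ u c)
  where
    open import Data.Product renaming (Σ to Σ'; _×_ to _×'_)

data Reach {n} (G : Game n) : State n → ℕ → Set where
  start : Reach G singletons 0
  step  : ∀ {σ σ' k} → Reach G σ k → Step1 G σ σ' → Reach G σ' (ℕ.suc k)

pos : ℤ∞ → ℕ
pos -∞ = 0
pos (fin (+ m)) = m
pos (fin -[1+ _ ]) = 0

wp : ∀ {n} → Game n → ℕ
wp {n} G = foldr _⊔_ 0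
  (map (λ u → foldr _⊔_ 0
     (map (λ v → pos (w G u v)) (filter (λ v → ¬? (v ≟ u)) (allFin n))))
   (allFin n))

module Submission where

-- The proof is by a potential.  Let share σ a b be the weight a receives from b in the
-- state σ (w_ab if b ≠ a lies in a's group, else 0), util σ a = Σ_b share σ a b the
-- utility of a, and potential σ = Σ_a util σ a.  Since shares are symmetric, the double
-- sum counts each intra-group pair twice; when u moves only the shares in row and column
-- u change, so the potential grows by exactly twice the gain of u (double-sum-cross).
-- A 1-deviation therefore raises the potential by at least 1.  It is 0 for the
-- all-singletons state and at most n · n · w_p, since every share is at most w_p.
-- The weight -∞ needs care only in one place: a player never moves into a group where
-- its utility is -∞, so along the dynamics no group contains two enemies (Compatible),
-- and all utilities are finite integers.

open import Defs
open import Data.Nat using (ℕ; _≤_; _*_)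
open import Data.Product using (∃)

import Data.Nat as ℕ
import Data.Nat.Properties as ℕP
open import Data.Nat.Solver using (module +-*-Solver)
open import Data.Integer as ℤ using (ℤ; +_; -[1+_]; 0ℤ; _+_; _-_)
import Data.Integer.Properties as ℤP
import Data.Integer.Solver as ℤSolver
open import Algebra.Properties.CommutativeMonoid.Sum ℤP.+-0-commutativeMonoid
  using (sum; sum-cong-≗; sum-replicate-zero; ∑-distrib-+; ∑-comm)
open import Data.Fin using (Fin; zero; suc; _≟_)
open import Data.Fin.Properties using (suc-injective)
import Data.Vec.Functional as Vector
open import Data.List using (List; []; _∷_; foldr; map; filter; allFin; tabulate)
open import Data.List.Membership.Propositional using (_∈_)
open import Data.List.Membership.Propositional.Properties using (∈-filter⁺; ∈-allFin)
open import Data.List.Relation.Unary.Any using (here; there)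
open import Data.Bool using (true; false; if_then_else_)
open import Data.Unit using (⊤; tt)
open import Data.Empty using (⊥)
open import Data.Product using (_×_; _,_; proj₁; proj₂)
open import Function using (_∘_; id)
open import Relation.Nullary using (¬_; ¬?; Dec; yes; no; does; contradiction)
open import Relation.Nullary.Decidable using (_×-dec_; dec-true; dec-false; toSum)
open import Data.Sum using (inj₁; inj₂)
open import Relation.Binary.PropositionalEquality
  using (_≡_; _≢_; refl; trans; cong; cong₂; subst; subst₂; ≢-sym; module ≡-Reasoning)
  renaming (sym to ≡-sym)

if-yes : ∀ {A P : Set} (p? : Dec P) {x y : A} → P → (if does p? then x else y) ≡ x
if-yes p? p rewrite dec-true p? p = refl

if-no : ∀ {A P : Set} (p? : Dec P) {x y : A} → ¬ P → (if does p? then x else y) ≡ y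
if-no p? ¬p rewrite dec-false p? ¬p = refl

IsFin : ℤ∞ → Set
IsFin -∞      = ⊥
IsFin (fin _) = ⊤

-- The integer value of a finite extended integer.
val : ℤ∞ → ℤ
val -∞      = 0ℤ
val (fin z) = z

⊕-finite⁻ : ∀ x y → IsFin (x ⊕ y) → IsFin x × IsFin y
⊕-finite⁻ (fin _) (fin _) _ = tt , tt

⊕-identityˡ : ∀ x → fin 0ℤ ⊕ x ≡ x
⊕-identityˡ -∞      = refl
⊕-identityˡ (fin z) = cong fin (ℤP.+-identityˡ z)

<∞-finite : ∀ {x y} → x <∞ y → IsFin y
<∞-finite -∞<fin      = tt
<∞-finite (fin<fin _) = tt

fin<fin⁻ : ∀ {a b} → fin a <∞ fin b → a ℤ.< b
fin<fin⁻ (fin<fin a<b) = a<b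

Σ∞ : ∀ {n} → (Fin n → ℤ∞) → ℤ∞
Σ∞ = Vector.foldr _⊕_ (fin 0ℤ)

-- Folding ⊕ over a filtered list is folding over the whole list with the rejected
-- entries replaced by 0; this turns the list-based utility of Defs into a sum over Fin n.
foldr-filter : ∀ {A : Set} {P : A → Set} (P? : ∀ x → Dec (P x)) (h : A → ℤ∞) (xs : List A) →
  foldr _⊕_ (fin 0ℤ) (map h (filter P? xs)) ≡
  foldr _⊕_ (fin 0ℤ) (map (λ x → if does (P? x) then h x else fin 0ℤ) xs)
foldr-filter P? h []       = refl
foldr-filter P? h (x ∷ xs) with does (P? x)
... | true  = cong (h x ⊕_) (foldr-filter P? h xs)
... | false = trans (foldr-filter P? h xs) (≡-sym (⊕-identityˡ _))

-- Since allFin n = tabulate id, a ⊕-fold over allFin n is a ⊕-sum over Fin n.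
foldr-tabulate : ∀ {A : Set} {n} (g : Fin n → A) (h : A → ℤ∞) →
  foldr _⊕_ (fin 0ℤ) (map h (tabulate g)) ≡ Σ∞ (h ∘ g)
foldr-tabulate {n = ℕ.zero}  g h = refl
foldr-tabulate {n = ℕ.suc n} g h = cong (h (g zero) ⊕_) (foldr-tabulate (g ∘ suc) h)

Σ∞-finite⁻ : ∀ {n} (f : Fin n → ℤ∞) → IsFin (Σ∞ f) → ∀ i → IsFin (f i)
Σ∞-finite⁻ f fin-Σ zero    = proj₁ (⊕-finite⁻ (f zero) _ fin-Σ)
Σ∞-finite⁻ f fin-Σ (suc i) = Σ∞-finite⁻ (f ∘ suc) (proj₂ (⊕-finite⁻ (f zero) _ fin-Σ)) i

Σ∞-finite : ∀ {n} (f : Fin n → ℤ∞) → (∀ i → IsFin (f i)) → Σ∞ f ≡ fin (sum (val ∘ f))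
Σ∞-finite {ℕ.zero}  f fin-f = refl
Σ∞-finite {ℕ.suc n} f fin-f with f zero | fin-f zero
... | fin z | _ rewrite Σ∞-finite (f ∘ suc) (fin-f ∘ suc) = refl

sum-zero : ∀ {n} (f : Fin n → ℤ) → (∀ i → f i ≡ 0ℤ) → sum f ≡ 0ℤ
sum-zero {n} f f≡0 = trans (sum-cong-≗ f≡0) (sum-replicate-zero n)

sum-at : ∀ {n} (f : Fin n → ℤ) (u : Fin n) → (∀ i → i ≢ u → f i ≡ 0ℤ) → sum f ≡ f u
sum-at f zero f≡0 =
  trans (cong (λ s → f zero + s) (sum-zero (f ∘ suc) (λ i → f≡0 (suc i) λ ())))
        (ℤP.+-identityʳ (f zero))
sum-at f (suc u) f≡0 =
  trans (cong₂ _+_ (f≡0 zero λ ())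
                   (sum-at (f ∘ suc) u (λ i i≢u → f≡0 (suc i) (i≢u ∘ suc-injective))))
        (ℤP.+-identityˡ (f (suc u)))

sum-≤ : ∀ {n} (f : Fin n → ℤ) m → (∀ i → f i ℤ.≤ + m) → sum f ℤ.≤ + (n * m)
sum-≤ {ℕ.zero}  f m f≤m = ℤP.≤-refl
sum-≤ {ℕ.suc n} f m f≤m = ℤP.+-mono-≤ (f≤m zero) (sum-≤ (f ∘ suc) m (f≤m ∘ suc))

-- The proof splits D into its u-th row R and the
-- transpose of R, and sums R both ways.
double-sum-cross : ∀ {n} (D : Fin n → Fin n → ℤ) (u : Fin n) →
  (∀ a b → D a b ≡ D b a) → D u u ≡ 0ℤ → (∀ a b → a ≢ u → b ≢ u → D a b ≡ 0ℤ) →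
  sum (λ a → sum (D a)) ≡ sum (D u) + sum (D u)
double-sum-cross {n} D u D-sym D-uu D-off = begin
  sum (λ a → sum (D a))
    ≡⟨ sum-cong-≗ (λ a → sum-cong-≗ (row+column a)) ⟩
  sum (λ a → sum (λ b → R a b + R b a))
    ≡⟨ sum-cong-≗ (λ a → ∑-distrib-+ (R a) (λ b → R b a)) ⟩
  sum (λ a → sum (R a) + sum (λ b → R b a))
    ≡⟨ ∑-distrib-+ (λ a → sum (R a)) (λ a → sum (λ b → R b a)) ⟩
  sum (λ a → sum (R a)) + sum (λ a → sum (λ b → R b a))
    ≡⟨ cong (λ s → sum (λ a → sum (R a)) + s) (∑-comm (λ a b → R b a)) ⟩
  sum (λ a → sum (R a)) + sum (λ a → sum (R a))
    ≡⟨ cong₂ _+_ row-sum row-sum ⟩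
  sum (D u) + sum (D u) ∎
  where
  open ≡-Reasoning

  R : Fin n → Fin n → ℤ
  R a b = if does (a ≟ u) then D a b else 0ℤ

  row+column : ∀ a b → D a b ≡ R a b + R b a
  row+column a b with a ≟ u | b ≟ u
  ... | yes refl | yes refl = trans D-uu (cong₂ _+_ (≡-sym D-uu) (≡-sym D-uu))
  ... | yes refl | no _     = ≡-sym (ℤP.+-identityʳ (D u b))
  ... | no _     | yes refl = trans (D-sym a u) (≡-sym (ℤP.+-identityˡ (D u a)))
  ... | no a≢u   | no b≢u   = D-off a b a≢u b≢u

  row-sum : sum (λ a → sum (R a)) ≡ sum (D u)
  row-sum = trans (sum-at (λ a → sum (R a)) u (λ a a≢u → sum-zero (R a) (λ b → if-no (a ≟ u) a≢u)))
                  (sum-cong-≗ (λ b → if-yes (u ≟ u) {D u b} refl))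

increment-positive : ∀ i x → i ℤ.< i + x → 0ℤ ℤ.< x
increment-positive i x i<i+x with 0ℤ ℤP.<? x
... | yes 0<x = 0<x
... | no  0≮x = contradiction
  (subst (i + x ℤ.≤_) (ℤP.+-identityʳ i) (ℤP.+-monoʳ-≤ i (ℤP.≮⇒≥ 0≮x)))
  (ℤP.<⇒≱ i<i+x)

≤-maximum : ∀ {A : Set} (f : A → ℕ) {x} {xs : List A} → x ∈ xs → f x ≤ foldr ℕ._⊔_ 0 (map f xs)
≤-maximum f {x}            (here refl) = ℕP.m≤m⊔n (f x) _
≤-maximum f {xs = y ∷ ys} (there x∈ys) = ℕP.m≤n⇒m≤o⊔n (f y) (≤-maximum f x∈ys)

val≤pos : ∀ x → val x ℤ.≤ + pos x
val≤pos -∞             = ℤP.≤-refl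
val≤pos (fin (+ m))    = ℤP.≤-refl
val≤pos (fin -[1+ m ]) = ℤ.-≤+

module _ {n : ℕ} (G : Game n) where

  Groupmates : State n → Fin n → Fin n → Set
  Groupmates σ a b = b ≢ a × σ b ≡ σ a

  groupmate? : ∀ σ a b → Dec (Groupmates σ a b)
  groupmate? σ a b = ¬? (b ≟ a) ×-dec (σ b ≟ σ a)

  groupmates-sym : ∀ {σ a b} → Groupmates σ a b → Groupmates σ b a
  groupmates-sym (b≢a , same) = ≢-sym b≢a , ≡-sym same

  link : State n → Fin n → Fin n → ℤ∞
  link σ a b = if does (groupmate? σ a b) then w G a b else fin 0ℤ

  link-in : ∀ {σ a b} → Groupmates σ a b → link σ a b ≡ w G a b
  link-in {σ} {a} {b} = if-yes (groupmate? σ a b)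

  link-out : ∀ {σ a b} → ¬ Groupmates σ a b → link σ a b ≡ fin 0ℤ
  link-out {σ} {a} {b} = if-no (groupmate? σ a b)

  link-sym : ∀ σ a b → link σ a b ≡ link σ b a
  link-sym σ a b with toSum (groupmate? σ a b)
  ... | inj₁ mates = trans (link-in mates)
                     (trans (Game.sym G a b (≢-sym (proj₁ mates))) (≡-sym (link-in (groupmates-sym mates))))
  ... | inj₂ apart = trans (link-out apart) (≡-sym (link-out (apart ∘ groupmates-sym)))

  utility-link : ∀ σ a → utility G σ a ≡ Σ∞ (link σ a)
  utility-link σ a = trans (foldr-filter (groupmate? σ a) (w G a) (allFin n))
                           (foldr-tabulate id (link σ a))

  Compatible : State n → Set
  Compatible σ = ∀ a b → Groupmates σ a b → IsFin (w G a b)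

  link-finite : ∀ {σ} → Compatible σ → ∀ a b → IsFin (link σ a b)
  link-finite {σ} compat a b with toSum (groupmate? σ a b)
  ... | inj₁ mates = subst IsFin (≡-sym (link-in mates)) (compat a b mates)
  ... | inj₂ apart = subst IsFin (≡-sym (link-out apart)) tt

  share : State n → Fin n → Fin n → ℤ
  share σ a b = val (link σ a b)

  util : State n → Fin n → ℤ
  util σ a = sum (share σ a)

  potential : State n → ℤ
  potential σ = sum (util σ)

  utility-finite : ∀ {σ} → Compatible σ → ∀ a → utility G σ a ≡ fin (util σ a)
  utility-finite {σ} compat a =
    trans (utility-link σ a) (Σ∞-finite (link σ a) (link-finite compat a))

  share-self : ∀ σ a → share σ a a ≡ 0ℤ
  share-self σ a = cong val (link-out {σ} {a} {a} (λ mates → proj₁ mates refl))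

  share-sym : ∀ σ a b → share σ a b ≡ share σ b a
  share-sym σ a b = cong val (link-sym σ a b)

  pos≤wp : ∀ a b → b ≢ a → pos (w G a b) ≤ wp G
  pos≤wp a b b≢a = ℕP.≤-trans
    (≤-maximum (λ v → pos (w G a v)) (∈-filter⁺ (λ v → ¬? (v ≟ a)) (∈-allFin b) b≢a))
    (≤-maximum (λ u → foldr ℕ._⊔_ 0 (map (λ v → pos (w G u v)) (filter (λ v → ¬? (v ≟ u)) (allFin n))))
               (∈-allFin a))

  share≤wp : ∀ σ a b → share σ a b ℤ.≤ + wp G
  share≤wp σ a b with toSum (groupmate? σ a b)
  ... | inj₁ mates = subst (ℤ._≤ + wp G) (≡-sym (cong val (link-in mates)))
                       (ℤP.≤-trans (val≤pos (w G a b)) (ℤ.+≤+ (pos≤wp a b (proj₁ mates))))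
  ... | inj₂ apart = subst (ℤ._≤ + wp G) (≡-sym (cong val (link-out apart))) (ℤ.+≤+ ℕ.z≤n)

  potential≤ : ∀ σ → potential σ ℤ.≤ + (n * (n * wp G))
  potential≤ σ = sum-≤ (util σ) (n * wp G) (λ a → sum-≤ (share σ a) (wp G) (share≤wp σ a))

  move-other : ∀ (σ : State n) {u} c {v} → v ≢ u → move σ u c v ≡ σ v
  move-other σ {u} c {v} = if-no (v ≟ u)

  share-frame : ∀ σ {u} c {a b} → a ≢ u → b ≢ u → share (move σ u c) a b ≡ share σ a b
  share-frame σ c {a} {b} a≢u b≢u =
    cong₂ (λ (x y : Fin n) → val (if does (¬? (b ≟ a) ×-dec (y ≟ x)) then w G a b else fin 0ℤ))
          (move-other σ c a≢u) (move-other σ c b≢u)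

  -- The potential grows by twice the gain of the moving player (in particular it
  -- grows whenever that player gains); no compatibility is needed here.
  potential-step : ∀ σ u c → util σ u ℤ.< util (move σ u c) u → potential σ ℤ.< potential (move σ u c)
  potential-step σ u c gain =
    subst (potential σ ℤ.<_) (≡-sym potential-shift)
      (subst (ℤ._< potential σ + (X + X)) (ℤP.+-identityʳ (potential σ))
        (ℤP.+-monoʳ-< (potential σ) (ℤP.+-mono-< X>0 X>0)))
    where
    σ' : State n
    σ' = move σ u c

    D : Fin n → Fin n → ℤ
    D a b = share σ' a b - share σ a b

    X : ℤ
    X = sum (D u)

    shift : ∀ a b → share σ' a b ≡ share σ a b + D a b
    shift a b = solve 2 (λ s' s → s' := s :+ (s' :- s)) refl (share σ' a b) (share σ a b)
      where open ℤSolver.+-*-Solver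

    row-shift : ∀ a → util σ' a ≡ util σ a + sum (D a)
    row-shift a = trans (sum-cong-≗ (shift a)) (∑-distrib-+ (share σ a) (D a))

    D-off : ∀ a b → a ≢ u → b ≢ u → D a b ≡ 0ℤ
    D-off a b a≢u b≢u = trans (cong (_- share σ a b) (share-frame σ c a≢u b≢u))
                              (ℤP.+-inverseʳ (share σ a b))

    potential-shift : potential σ' ≡ potential σ + (X + X)
    potential-shift = begin
      sum (util σ')                                  ≡⟨ sum-cong-≗ row-shift ⟩
      sum (λ a → util σ a + sum (D a))               ≡⟨ ∑-distrib-+ (util σ) (λ a → sum (D a)) ⟩
      potential σ + sum (λ a → sum (D a))            ≡⟨ cong (λ s → potential σ + s) double-sum ⟩
      potential σ + (X + X)                          ∎
      where
      open ≡-Reasoning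
      double-sum : sum (λ a → sum (D a)) ≡ X + X
      double-sum = double-sum-cross D u
        (λ a b → cong₂ _-_ (share-sym σ' a b) (share-sym σ a b))
        (cong₂ _-_ (share-self σ' u) (share-self σ u))
        D-off

    X>0 : 0ℤ ℤ.< X
    X>0 = increment-positive (util σ u) X (subst (util σ u ℤ.<_) (row-shift u) gain)

  -- A player only moves to a group where its utility is finite, so compatibility is kept.
  compatible-move : ∀ σ u c → Compatible σ → IsFin (utility G (move σ u c) u) →
                    Compatible (move σ u c)
  compatible-move σ u c compat finite-u = compat′
    where
    σ' : State n
    σ' = move σ u c

    u-links : ∀ b → IsFin (link σ' u b)
    u-links = Σ∞-finite⁻ (link σ' u) (subst IsFin (utility-link σ' u) finite-u)

    compat′ : Compatible σ'
    compat′ a b mates with toSum (a ≟ u) | toSum (b ≟ u)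
    ... | inj₁ refl | _         = subst IsFin (link-in mates) (u-links b)
    ... | inj₂ a≢u  | inj₁ refl = subst IsFin (Game.sym G u a (≢-sym a≢u))
                                   (subst IsFin (link-in (groupmates-sym mates)) (u-links a))
    ... | inj₂ a≢u  | inj₂ b≢u  = compat a b
      (proj₁ mates , trans (≡-sym (move-other σ c b≢u)) (trans (proj₂ mates) (move-other σ c a≢u)))

  compatible-singletons : Compatible singletons
  compatible-singletons a b (b≢a , same) = contradiction same b≢a

  potential-singletons : potential singletons ≡ 0ℤ
  potential-singletons = sum-zero (util singletons) (λ a → sum-zero (share singletons a)
    (λ b → cong val (link-out {singletons} {a} {b} (λ mates → proj₁ mates (proj₂ mates)))))

  reachable : ∀ {σ k} → Reach G σ k → Compatible σ × (+ k ℤ.≤ potential σ)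
  reachable start = compatible-singletons , ℤP.≤-reflexive (≡-sym potential-singletons)
  reachable (step {σ} r (u , c , improves , refl)) = compat′ , ℤP.i<j⇒suc[i]≤j (ℤP.≤-<-trans k≤Φ Φ<Φ′)
    where
    compat : Compatible σ
    compat = proj₁ (reachable r)

    k≤Φ : + _ ℤ.≤ potential σ
    k≤Φ = proj₂ (reachable r)

    compat′ : Compatible (move σ u c)
    compat′ = compatible-move σ u c compat (<∞-finite improves)

    Φ<Φ′ : potential σ ℤ.< potential (move σ u c)
    Φ<Φ′ = potential-step σ u c
      (fin<fin⁻ (subst₂ _<∞_ (utility-finite compat u) (utility-finite compat′ u) improves))

steps-bound : ∀ {n} (G : Game n) {σ k} → Reach G σ k → k ≤ n * (n * wp G)
steps-bound G {σ} r = ℤP.drop‿+≤+ (ℤP.≤-trans (proj₂ (reachable G r)) (potential≤ G σ))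

theorem5 : ∃ λ (C : ℕ) → ∀ (n : ℕ) (G : Game n) (σ : State n) (k : ℕ) →
    Reach G σ k → k ≤ C * wp G * n * n
theorem5 = 1 , λ n G σ k r → subst (k ≤_) (reorder n (wp G)) (steps-bound G r)
  where
  open +-*-Solver
  reorder : ∀ n p → n * (n * p) ≡ 1 * p * n * n
  reorder = solve 2 (λ n p → n :* (n :* p) := con 1 :* p :* n :* n) refl
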